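{- Let $e=(\mathbf e_1,\dots,\mathbf e_{q_1})$, $f=(\mathbf f_1,\dots,\mathbf f_{q_2})$ be two disjoint sequences of nonzero vectors in $\mathbb N^d$ with $|e|=|f|$, $\Delta\geq0$ on $[0,1]^d$ and $\Delta\geq1$ on $\mathcal D$, and let $p$ be a prime. Let $s\in\mathbb N$, $\mathbf v\in\{0,\dots,p-1\}^d$ and $\mathbf u\in\{0,\dots,p^s-1\}^d$. If there exists $j\in\{1,\dots,s+1\}$ with $\{(\mathbf v+\mathbf up)/p^j\}\notin\mathcal D$, then for every $\mathbf m\in\mathbb N^d$, $Y_s(\mathbf v,\mathbf u,\mathbf m)\in1+p^{s-j+2}\mathbb Z_p$.
   Context: $\Delta(\mathbf x)=\sum_i\lfloor\mathbf e_i\cdot\mathbf x\rfloor-\sum_j\lfloor\mathbf f_j\cdot\mathbf x\rfloor$; $\mathcal D$ is the set of $\mathbf x\in[0,1)^d$ with $\mathbf d\cdot\mathbf x\geq1$ for some $\mathbf d\in\{\mathbf e_1,\dots,\mathbf f_{q_2}\}$; $\{\cdot\}$ is coordinatewise fractional part. $Y_s(\mathbf v,\mathbf u,\mathbf m)=\frac{\prod_{i=1}^{q_2}\prod_{j=1}^{\lfloor\mathbf f_i\cdot\mathbf v/p\rfloor}\big(1+\frac{\mathbf f_i\cdot\mathbf mp^s}{\mathbf f_i\cdot\mathbf u+j}\big)}{\prod_{i=1}^{q_1}\prod_{j=1}^{\lfloor\mathbf e_i\cdot\mathbf v/p\rfloor}\big(1+\frac{\mathbf e_i\cdot\mathbf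 mp^s}{\mathbf e_i\cdot\mathbf u+j}\big)}$. -}

module Defs where

open import Data.Nat as ℕ using (ℕ; zero; suc; NonZero)
open import Data.Nat.Properties using (m^n≢0)
open import Data.Nat.Primality using (Prime; prime⇒nonZero)
open import Data.Nat.Divisibility using (_∣_)
open import Data.Integer as ℤ using (ℤ; +_)
open import Data.Rational as ℚ using (ℚ; floor; _/_)
open import Data.Fin using (Fin; zero; suc)
open import Data.Product using (Σ; ∃; _×_; _,_)
open import Relation.Binary.PropositionalEquality using (_≡_)
open import Relation.Nullary using (¬_)

Σℕ : (n : ℕ) → (Fin n → ℕ) → ℕ
Σℕ zero    g = 0
Σℕ (suc n) g = g zero ℕ.+ Σℕ n (λ i → g (suc i))

Σℤ : (n : ℕ) → (Fin n → ℤ) → ℤ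
Σℤ zero    g = + 0
Σℤ (suc n) g = g zero ℤ.+ Σℤ n (λ i → g (suc i))

Σℚ : (n : ℕ) → (Fin n → ℚ) → ℚ
Σℚ zero    g = ℚ.0ℚ
Σℚ (suc n) g = g zero ℚ.+ Σℚ n (λ i → g (suc i))

ΠFinℚ : (n : ℕ) → (Fin n → ℚ) → ℚ
ΠFinℚ zero    g = ℚ.1ℚ
ΠFinℚ (suc n) g = g zero ℚ.* ΠFinℚ n (λ i → g (suc i))

Πℚ : (n : ℕ) → (ℕ → ℚ) → ℚ
Πℚ zero    g = ℚ.1ℚ
Πℚ (suc n) g = g 0 ℚ.* Πℚ n (λ k → g (suc k))

Vecℕ : ℕ → Set
Vecℕ d = Fin d → ℕ

Vecℚ : ℕ → Set
Vecℚ d = Fin d → ℚ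

ℕtoℚ : ℕ → ℚ
ℕtoℚ n = (+ n) / 1

ℤtoℚ : ℤ → ℚ
ℤtoℚ z = z / 1

_·ℕ_ : ∀ {d} → Vecℕ d → Vecℕ d → ℕ
_·ℕ_ {d} a b = Σℕ d (λ k → a k ℕ.* b k)

_·ℚ_ : ∀ {d} → Vecℕ d → Vecℚ d → ℚ
_·ℚ_ {d} a x = Σℚ d (λ k → ℕtoℚ (a k) ℚ.* x k)

Δ : ∀ {d q₁ q₂} → (Fin q₁ → Vecℕ d) → (Fin q₂ → Vecℕ d) → Vecℚ d → ℤ
Δ {d} {q₁} {q₂} e f x =
  Σℤ q₁ (λ i → floor (e i ·ℚ x)) ℤ.- Σℤ q₂ (λ j → floor (f j ·ℚ x))

In𝒟 : ∀ {d q₁ q₂} → (Fin q₁ → Vecℕ d) → (Fin q₂ → Vecℕ d) → Vecℚ d → Set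
In𝒟 e f x =
  (∀ k → ℚ.0ℚ ℚ.≤ x k × x k ℚ.< ℚ.1ℚ) ×
  ((∃ λ i → ℚ.1ℚ ℚ.≤ (e i ·ℚ x)) Data.Sum.⊎ (∃ λ j → ℚ.1ℚ ℚ.≤ (f j ·ℚ x)))
  where import Data.Sum

frac : ℚ → ℚ
frac q = q ℚ.- ℤtoℚ (floor q)

fracPt : ∀ {d} (p : ℕ) → Prime p → Vecℕ d → Vecℕ d → ℕ → Vecℚ d
fracPt p pp v u j k =
  frac (_/_ (+ (v k ℕ.+ u k ℕ.* p)) (p ℕ.^ j) {{m^n≢0 p j {{prime⇒nonZero pp}}}})

-- one factor 1 + c/(a + j), with j = suc k ≥ 1 (denominator a + j > 0)
factor : ℕ → ℕ → ℕ → ℚ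
factor c a k = ℚ.1ℚ ℚ.+ ((+ c) / suc (k ℕ.+ a))

-- its inverse (1 + c/(a + j))⁻¹ = (a + j)/(a + j + c), written without ℚ-inversion
factorInv : ℕ → ℕ → ℕ → ℚ
factorInv c a k = (+ suc (k ℕ.+ a)) / suc (k ℕ.+ a ℕ.+ c)

Y : ∀ {d q₁ q₂} → (Fin q₁ → Vecℕ d) → (Fin q₂ → Vecℕ d) →
    (p : ℕ) → Prime p → (s : ℕ) → Vecℕ d → Vecℕ d → Vecℕ d → ℚ
Y {d} {q₁} {q₂} e f p pp s v u m =
  ΠFinℚ q₂ (λ i → prodF (f i)) ℚ.* ΠFinℚ q₁ (λ i → prodE (e i))
  where
  instance _ = prime⇒nonZero pp
  prodF prodE : Vecℕ d → ℚ
  prodF g = Πℚ ((g ·ℕ v) ℕ./ p) (factor ((g ·ℕ m) ℕ.* p ℕ.^ s) (g ·ℕ u))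
  prodE g = Πℚ ((g ·ℕ v) ℕ./ p) (factorInv ((g ·ℕ m) ℕ.* p ℕ.^ s) (g ·ℕ u))

-- y ∈ 1 + p^k ℤ_p  (y rational): y - 1 = p^k a / b with a ∈ ℤ, b ∈ ℕ, p ∤ b
In1+pℤp : (p k : ℕ) → ℚ → Set
In1+pℤp p k y = Σ ℤ λ a → Σ ℕ λ b →
  (¬ (p ∣ b)) × ((y ℚ.- ℚ.1ℚ) ℚ.* ℕtoℚ b ≡ ℕtoℚ (p ℕ.^ k) ℚ.* ℤtoℚ a)

module Submission where

-- Write j = j' + 1 and D = p^j = p·Q with Q = p^j'.  The coordinates of the
-- point {(v + u p)/p^j} are M_k / D with M_k = (v_k + u_k p) mod D
-- = v_k + p (u_k mod Q).  Since this point lies in [0,1)^d but not in 𝒟, every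
-- vector g among the e_i, f_i has weight Σ_k g_k M_k < D.  A short counting
-- argument turns this into: none of the integers g·u + 1, …, g·u + ⌊g·v/p⌋ is
-- divisible by Q.  For such an integer n = p^ℓ n' we have ℓ < j', hence every
-- factor 1 + c/n and n/(n + c) of Y_s, where c = (g·m) p^s, lies in
-- 1 + p^K ℤ_(p) with K = s + 2 - j.  Since 1 + p^K ℤ_(p) is multiplicatively
-- closed, it contains the product Y_s of these factors.

open import Defs
open import Data.Nat using (ℕ; _≤_; _<_; _+_; _∸_; _^_)
open import Data.Nat.Primality using (Prime)
open import Data.Integer as ℤ using (ℤ)
open import Data.Rational as ℚ using (ℚ)
open import Data.Fin using (Fin)
open import Data.Product using (Σ; _×_)
open import Relation.Binary.PropositionalEquality using (_≡_)
open import Relation.Nullary using (¬_)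

open import Data.Nat as ℕ using (zero; suc; NonZero; _*_; z≤n; s≤s)
import Data.Nat.Properties as ℕP
import Data.Nat.DivMod as ℕD
open import Data.Nat.Divisibility as ℕ∣ using (_∣_; divides)
open import Data.Nat.GCD using (gcd; gcd[m,n]∣m; gcd[m,n]∣n; gcd[m,n]≢0; n/gcd[m,n]≢0)
open import Data.Nat.Coprimality using (Coprime; coprime-/gcd)
open import Data.Nat.Primality using (euclidsLemma; prime⇒nonZero; prime⇒nonTrivial)
open import Data.Integer using (+_)
import Data.Integer.Properties as ℤP
open import Data.Rational using (_/_; toℚᵘ)
import Data.Rational.Properties as ℚP
open import Data.Rational.Unnormalised using (mkℚᵘ; _≃_; *≡*; *≤*; *<*)
import Data.Rational.Unnormalised.Properties as ℚᵘP
open import Data.Fin using (zero; suc)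
open import Data.Sum using (inj₁; inj₂)
open import Data.Product using (_,_; proj₁; proj₂)
open import Data.Empty using (⊥-elim)
open import Relation.Nullary using (yes; no)
open import Function using (_∘_)
open import Relation.Binary.PropositionalEquality using (refl; sym; trans; cong; cong₂; subst; subst₂; module ≡-Reasoning)
import Data.Nat.Solver as ℕSolver
import Data.Integer.Solver as ℤSolver
import Data.Rational.Solver as ℚSolver

-- A normalised fraction i / n is compared with others
-- through its unnormalised representative, where all operations are the
-- schoolbook formulas and equality is cross-multiplication.

toℚᵘ-/ : ∀ i n .{{_ : NonZero n}} → toℚᵘ (i / n) ≃ mkℚᵘ i (ℕ.pred n)
toℚᵘ-/ i (suc n) = ℚP.toℚᵘ-fromℚᵘ (mkℚᵘ i n)

/-cross : ∀ i n j m .{{_ : NonZero n}} .{{_ : NonZero m}} →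
          i ℤ.* + m ≡ j ℤ.* + n → i / n ≡ j / m
/-cross i n@(suc _) j m@(suc _) eq = ℚP.toℚᵘ-injective
  (ℚᵘP.≃-trans (toℚᵘ-/ i n) (ℚᵘP.≃-trans (*≡* eq) (ℚᵘP.≃-sym (toℚᵘ-/ j m))))

/-* : ∀ i n j m .{{_ : NonZero n}} .{{_ : NonZero m}} →
      (i / n) ℚ.* (j / m) ≡ ((i ℤ.* j) / (n * m)) {{ℕP.m*n≢0 n m}}
/-* i n@(suc _) j m@(suc _) = ℚP.toℚᵘ-injective
  (ℚᵘP.≃-trans (ℚP.toℚᵘ-homo-* (i / n) (j / m))
  (ℚᵘP.≃-trans (ℚᵘP.*-cong (toℚᵘ-/ i n) (toℚᵘ-/ j m))
               (ℚᵘP.≃-sym (toℚᵘ-/ (i ℤ.* j) (n * m)))))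

/-+ : ∀ i n j m .{{_ : NonZero n}} .{{_ : NonZero m}} →
      (i / n) ℚ.+ (j / m) ≡ ((i ℤ.* + m ℤ.+ j ℤ.* + n) / (n * m)) {{ℕP.m*n≢0 n m}}
/-+ i n@(suc _) j m@(suc _) = ℚP.toℚᵘ-injective
  (ℚᵘP.≃-trans (ℚP.toℚᵘ-homo-+ (i / n) (j / m))
  (ℚᵘP.≃-trans (ℚᵘP.+-cong (toℚᵘ-/ i n) (toℚᵘ-/ j m))
               (ℚᵘP.≃-sym (toℚᵘ-/ _ (n * m)))))

/-neg : ∀ i n .{{_ : NonZero n}} → ℚ.- (i / n) ≡ (ℤ.- i) / n
/-neg i n@(suc _) = ℚP.toℚᵘ-injective
  (ℚᵘP.≃-trans (ℚP.toℚᵘ-homo‿- (i / n))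
  (ℚᵘP.≃-trans (ℚᵘP.-‿cong (toℚᵘ-/ i n)) (ℚᵘP.≃-sym (toℚᵘ-/ _ n))))

/-≤ : ∀ i n j m .{{_ : NonZero n}} .{{_ : NonZero m}} →
      i ℤ.* + m ℤ.≤ j ℤ.* + n → i / n ℚ.≤ j / m
/-≤ i n@(suc _) j m@(suc _) le = ℚP.toℚᵘ-cancel-≤
  (ℚᵘP.≤-respʳ-≃ (ℚᵘP.≃-sym (toℚᵘ-/ j m)) (ℚᵘP.≤-respˡ-≃ (ℚᵘP.≃-sym (toℚᵘ-/ i n)) (*≤* le)))

/-< : ∀ i n j m .{{_ : NonZero n}} .{{_ : NonZero m}} →
      i ℤ.* + m ℤ.< j ℤ.* + n → i / n ℚ.< j / m
/-< i n@(suc _) j m@(suc _) lt = ℚP.toℚᵘ-cancel-<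
  (ℚᵘP.<-respʳ-≃ (ℚᵘP.≃-sym (toℚᵘ-/ j m)) (ℚᵘP.<-respˡ-≃ (ℚᵘP.≃-sym (toℚᵘ-/ i n)) (*<* lt)))

ℤtoℚ-+ : ∀ a b → ℤtoℚ (a ℤ.+ b) ≡ ℤtoℚ a ℚ.+ ℤtoℚ b
ℤtoℚ-+ a b = sym (trans (/-+ a 1 b 1)
  (cong (_/ 1) (cong₂ ℤ._+_ (ℤP.*-identityʳ a) (ℤP.*-identityʳ b))))

ℤtoℚ-* : ∀ a b → ℤtoℚ (a ℤ.* b) ≡ ℤtoℚ a ℚ.* ℤtoℚ b
ℤtoℚ-* a b = sym (/-* a 1 b 1)

ℕtoℚ-* : ∀ a b → ℕtoℚ (a * b) ≡ ℕtoℚ a ℚ.* ℕtoℚ b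
ℕtoℚ-* a b = trans (cong ℤtoℚ (ℤP.pos-* a b)) (ℤtoℚ-* (+ a) (+ b))

prime∤1 : ∀ {p} → Prime p → ¬ (p ∣ 1)
prime∤1 pp p∣1 = ℕ.nonTrivial⇒≢1 {{prime⇒nonTrivial pp}} (ℕ∣.∣1⇒≡1 p∣1)

1∈1+pᴷℤₚ : ∀ {p} K → Prime p → In1+pℤp p K ℚ.1ℚ
1∈1+pᴷℤₚ {p} K pp = ℤ.0ℤ , 1 , prime∤1 pp , sym (ℚP.*-zeroʳ (ℕtoℚ (p ^ K)))

*-deviation : ∀ y₁ y₂ B₁ B₂ →
  (y₁ ℚ.* y₂ ℚ.- ℚ.1ℚ) ℚ.* (B₁ ℚ.* B₂)
  ≡ ((y₁ ℚ.- ℚ.1ℚ) ℚ.* B₁) ℚ.* ((y₂ ℚ.- ℚ.1ℚ) ℚ.* B₂)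
    ℚ.+ ((y₁ ℚ.- ℚ.1ℚ) ℚ.* B₁) ℚ.* B₂ ℚ.+ ((y₂ ℚ.- ℚ.1ℚ) ℚ.* B₂) ℚ.* B₁
*-deviation = solve 4 (λ y₁ y₂ B₁ B₂ →
    (y₁ :* y₂ :- con ℚ.1ℚ) :* (B₁ :* B₂)
    := ((y₁ :- con ℚ.1ℚ) :* B₁) :* ((y₂ :- con ℚ.1ℚ) :* B₂)
       :+ ((y₁ :- con ℚ.1ℚ) :* B₁) :* B₂ :+ ((y₂ :- con ℚ.1ℚ) :* B₂) :* B₁) refl
  where open ℚSolver.+-*-Solver

-- Closure under products: with yᵢ - 1 = P aᵢ / bᵢ (P = p^K), the deviation
-- gives y₁ y₂ - 1 = P (P a₁ a₂ + a₁ b₂ + a₂ b₁) / (b₁ b₂), and p ∤ b₁ b₂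
-- because p is prime.
*-1+pᴷℤₚ : ∀ {p} K → Prime p → ∀ {y₁ y₂} →
           In1+pℤp p K y₁ → In1+pℤp p K y₂ → In1+pℤp p K (y₁ ℚ.* y₂)
*-1+pᴷℤₚ {p} K pp {y₁} {y₂} (a₁ , b₁ , p∤b₁ , eq₁) (a₂ , b₂ , p∤b₂ , eq₂) =
  a , b₁ * b₂ , p∤b₁b₂ , eq
  where
  P a : ℤ
  P = + (p ^ K)
  a = P ℤ.* a₁ ℤ.* a₂ ℤ.+ a₁ ℤ.* + b₂ ℤ.+ a₂ ℤ.* + b₁
  p∤b₁b₂ : ¬ (p ∣ b₁ * b₂)
  p∤b₁b₂ p∣b₁b₂ with euclidsLemma b₁ b₂ pp p∣b₁b₂
  ... | inj₁ p∣b₁ = p∤b₁ p∣b₁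
  ... | inj₂ p∣b₂ = p∤b₂ p∣b₂
  P′ A₁ A₂ B₁ B₂ : ℚ
  P′ = ℤtoℚ P
  A₁ = ℤtoℚ a₁
  A₂ = ℤtoℚ a₂
  B₁ = ℕtoℚ b₁
  B₂ = ℕtoℚ b₂
  a-in-ℚ : ℤtoℚ a ≡ P′ ℚ.* A₁ ℚ.* A₂ ℚ.+ A₁ ℚ.* B₂ ℚ.+ A₂ ℚ.* B₁
  a-in-ℚ = trans (ℤtoℚ-+ (P ℤ.* a₁ ℤ.* a₂ ℤ.+ a₁ ℤ.* + b₂) (a₂ ℤ.* + b₁))
    (cong₂ ℚ._+_ (trans (ℤtoℚ-+ (P ℤ.* a₁ ℤ.* a₂) (a₁ ℤ.* + b₂))
                        (cong₂ ℚ._+_ (trans (ℤtoℚ-* (P ℤ.* a₁) a₂) (cong (ℚ._* A₂) (ℤtoℚ-* P a₁)))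
                                     (ℤtoℚ-* a₁ (+ b₂))))
                 (ℤtoℚ-* a₂ (+ b₁)))
  open ≡-Reasoning
  open ℚSolver.+-*-Solver
  eq : (y₁ ℚ.* y₂ ℚ.- ℚ.1ℚ) ℚ.* ℕtoℚ (b₁ * b₂) ≡ P′ ℚ.* ℤtoℚ a
  eq = begin
    (y₁ ℚ.* y₂ ℚ.- ℚ.1ℚ) ℚ.* ℕtoℚ (b₁ * b₂)
      ≡⟨ cong ((y₁ ℚ.* y₂ ℚ.- ℚ.1ℚ) ℚ.*_) (ℕtoℚ-* b₁ b₂) ⟩
    (y₁ ℚ.* y₂ ℚ.- ℚ.1ℚ) ℚ.* (B₁ ℚ.* B₂)
      ≡⟨ *-deviation y₁ y₂ B₁ B₂ ⟩
    ((y₁ ℚ.- ℚ.1ℚ) ℚ.* B₁) ℚ.* ((y₂ ℚ.- ℚ.1ℚ) ℚ.* B₂)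
      ℚ.+ ((y₁ ℚ.- ℚ.1ℚ) ℚ.* B₁) ℚ.* B₂ ℚ.+ ((y₂ ℚ.- ℚ.1ℚ) ℚ.* B₂) ℚ.* B₁
      ≡⟨ cong₂ (λ X₁ X₂ → X₁ ℚ.* X₂ ℚ.+ X₁ ℚ.* B₂ ℚ.+ X₂ ℚ.* B₁) eq₁ eq₂ ⟩
    (P′ ℚ.* A₁) ℚ.* (P′ ℚ.* A₂) ℚ.+ (P′ ℚ.* A₁) ℚ.* B₂ ℚ.+ (P′ ℚ.* A₂) ℚ.* B₁
      ≡⟨ solve 5 (λ P A₁ A₂ B₁ B₂ →
           (P :* A₁) :* (P :* A₂) :+ (P :* A₁) :* B₂ :+ (P :* A₂) :* B₁
           := P :* (P :* A₁ :* A₂ :+ A₁ :* B₂ :+ A₂ :* B₁))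
         refl P′ A₁ A₂ B₁ B₂ ⟩
    P′ ℚ.* (P′ ℚ.* A₁ ℚ.* A₂ ℚ.+ A₁ ℚ.* B₂ ℚ.+ A₂ ℚ.* B₁)
      ≡⟨ cong (P′ ℚ.*_) (sym a-in-ℚ) ⟩
    P′ ℚ.* ℤtoℚ a ∎

Πℚ-1+pᴷℤₚ : ∀ {p} K → Prime p → ∀ n g →
            (∀ k → k < n → In1+pℤp p K (g k)) → In1+pℤp p K (Πℚ n g)
Πℚ-1+pᴷℤₚ K pp zero    g _ = 1∈1+pᴷℤₚ K pp
Πℚ-1+pᴷℤₚ K pp (suc n) g h = *-1+pᴷℤₚ K pp {g 0} (h 0 (s≤s z≤n))
  (Πℚ-1+pᴷℤₚ K pp n (λ k → g (suc k)) (λ k k<n → h (suc k) (s≤s k<n)))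

ΠFinℚ-1+pᴷℤₚ : ∀ {p} K → Prime p → ∀ n g →
               (∀ i → In1+pℤp p K (g i)) → In1+pℤp p K (ΠFinℚ n g)
ΠFinℚ-1+pᴷℤₚ K pp zero    g _ = 1∈1+pᴷℤₚ K pp
ΠFinℚ-1+pᴷℤₚ K pp (suc n) g h = *-1+pᴷℤₚ K pp {g zero} (h zero)
  (ΠFinℚ-1+pᴷℤₚ K pp n (λ i → g (suc i)) (λ i → h (suc i)))

-- With n = a + k + 1, a factor of the numerator of Y_s
-- is 1 + c/n and a factor of the denominator contributes n/(n + c).  Both lie
-- in 1 + p^K ℤ_(p) as soon as c/n ∈ p^K ℤ_(p), which is the following notion.

pow-mono-∣ : ∀ p {a b} → a ≤ b → p ^ a ∣ p ^ b
pow-mono-∣ p {a} {b} a≤b = divides (p ^ (b ∸ a))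
  (trans (cong (p ^_) (sym (ℕP.m+[n∸m]≡n a≤b)))
  (trans (ℕP.^-distribˡ-+-* p a (b ∸ a)) (ℕP.*-comm (p ^ a) _)))

-- c/n ∈ p^K ℤ_(p): c · n' = n · p^K · t for some t and some n' prime to p.
RatioIn : (p K c n : ℕ) → Set
RatioIn p K c n = Σ ℕ λ n' → Σ ℕ λ t → ¬ (p ∣ n') × c * n' ≡ n * (p ^ K * t)

fraction-1+pᴷℤₚ : ∀ p K y i n .{{_ : NonZero n}} b a → ¬ (p ∣ b) →
                  y ℚ.- ℚ.1ℚ ≡ i / n → i ℤ.* + b ≡ + n ℤ.* (+ (p ^ K) ℤ.* a) →
                  In1+pℤp p K y
fraction-1+pᴷℤₚ p K y i n b a p∤b y-1≡i/n ib≡nPa = a , b , p∤b , (begin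
  (y ℚ.- ℚ.1ℚ) ℚ.* ℕtoℚ b             ≡⟨ cong (ℚ._* ℕtoℚ b) y-1≡i/n ⟩
  (i / n) ℚ.* ((+ b) / 1)             ≡⟨ /-* i n (+ b) 1 ⟩
  ((i ℤ.* + b) / (n * 1)) {{_}}      ≡⟨ /-cross (i ℤ.* + b) (n * 1) (P ℤ.* a) 1 {{ℕP.m*n≢0 n 1}} cross ⟩
  (P ℤ.* a) / 1                       ≡⟨ sym (/-* P 1 a 1) ⟩
  ℕtoℚ (p ^ K) ℚ.* ℤtoℚ a             ∎)
  where
  open ≡-Reasoning
  P : ℤ
  P = + (p ^ K)
  cross : i ℤ.* + b ℤ.* + 1 ≡ P ℤ.* a ℤ.* + (n * 1)
  cross = trans (ℤP.*-identityʳ (i ℤ.* + b))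
         (trans ib≡nPa
         (trans (ℤP.*-comm (+ n) (P ℤ.* a))
                (cong (λ z → P ℤ.* a ℤ.* + z) (sym (ℕP.*-identityʳ n)))))

RatioIn-ℤ : ∀ p K c n n' t → c * n' ≡ n * (p ^ K * t) →
            + c ℤ.* + n' ≡ + n ℤ.* (+ (p ^ K) ℤ.* + t)
RatioIn-ℤ p K c n n' t eq =
  trans (sym (ℤP.pos-* c n'))
  (trans (cong +_ eq)
  (trans (ℤP.pos-* n (p ^ K * t)) (cong (+ n ℤ.*_) (ℤP.pos-* (p ^ K) t))))

factor-1+pᴷℤₚ : ∀ {p K} c a k → RatioIn p K c (suc (k + a)) →
                In1+pℤp p K (factor c a k)
factor-1+pᴷℤₚ {p} {K} c a k (n' , t , p∤n' , eq) =
  fraction-1+pᴷℤₚ p K (factor c a k) (+ c) (suc (k + a)) n' (+ t) p∤n' (1+x-1≡x ((+ c) / suc (k + a)))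
    (RatioIn-ℤ p K c (suc (k + a)) n' t eq)
  where
  open ℚSolver.+-*-Solver
  1+x-1≡x : ∀ x → (ℚ.1ℚ ℚ.+ x) ℚ.- ℚ.1ℚ ≡ x
  1+x-1≡x = solve 1 (λ x → (con ℚ.1ℚ :+ x) :- con ℚ.1ℚ := x) refl

factorInv-1 : ∀ c a k → factorInv c a k ℚ.- ℚ.1ℚ ≡ (ℤ.- + c) / suc (k + a + c)
factorInv-1 c a k =
  trans (cong ((+ n / N) ℚ.+_) (/-neg (+ 1) 1))
  (trans (/-+ (+ n) N (ℤ.- + 1) 1)
         (/-cross (+ n ℤ.* + 1 ℤ.+ ℤ.- + 1 ℤ.* + N) (N * 1) (ℤ.- + c) N {{ℕP.m*n≢0 N 1}} cross))
  where
  open ≡-Reasoning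
  open ℤSolver.+-*-Solver
  n N : ℕ
  n = suc (k + a)
  N = suc (k + a + c)
  cross : (+ n ℤ.* + 1 ℤ.+ ℤ.- + 1 ℤ.* + N) ℤ.* + N ≡ ℤ.- + c ℤ.* + (N * 1)
  cross = begin
    (+ n ℤ.* + 1 ℤ.+ ℤ.- + 1 ℤ.* + N) ℤ.* + N
      ≡⟨ cong (λ z → (+ n ℤ.* + 1 ℤ.+ ℤ.- + 1 ℤ.* z) ℤ.* + N) (ℤP.pos-+ n c) ⟩
    (+ n ℤ.* + 1 ℤ.+ ℤ.- + 1 ℤ.* (+ n ℤ.+ + c)) ℤ.* + N
      ≡⟨ solve 3 (λ n c N → (n :* con (+ 1) :+ :- con (+ 1) :* (n :+ c)) :* N
                            := :- c :* (N :* con (+ 1))) refl (+ n) (+ c) (+ N) ⟩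
    ℤ.- + c ℤ.* (+ N ℤ.* + 1)
      ≡⟨ cong (ℤ.- + c ℤ.*_) (sym (ℤP.pos-* N 1)) ⟩
    ℤ.- + c ℤ.* + (N * 1) ∎

-- For the denominator factors we need K ≥ 1: then p divides n' + p^K t,
-- the denominator of n/(n + c) - 1 = -p^K t/(n' + p^K t), only if p ∣ n'.
factorInv-1+pᴷℤₚ : ∀ {p K} c a k → 1 ≤ K → RatioIn p K c (suc (k + a)) →
                   In1+pℤp p K (factorInv c a k)
factorInv-1+pᴷℤₚ {p} {K} c a k 1≤K (n' , t , p∤n' , eq) =
  fraction-1+pᴷℤₚ p K (factorInv c a k) (ℤ.- + c) (suc (k + a + c)) (n' + P * t) (ℤ.- + t) p∤b (factorInv-1 c a k) cross
  where
  open ≡-Reasoning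
  open ℤSolver.+-*-Solver
  P n : ℕ
  P = p ^ K
  n = suc (k + a)
  p∣P : p ∣ P
  p∣P = subst (_∣ P) (ℕP.*-identityʳ p) (pow-mono-∣ p 1≤K)
  p∤b : ¬ (p ∣ n' + P * t)
  p∤b p∣b = p∤n' (ℕ∣.∣m+n∣m⇒∣n (subst (p ∣_) (ℕP.+-comm n' (P * t)) p∣b) (ℕ∣.∣m⇒∣m*n t p∣P))
  cross : ℤ.- + c ℤ.* + (n' + P * t) ≡ + (n + c) ℤ.* (+ P ℤ.* ℤ.- + t)
  cross = begin
    ℤ.- + c ℤ.* + (n' + P * t)
      ≡⟨ cong (ℤ.- + c ℤ.*_) (trans (ℤP.pos-+ n' (P * t)) (cong (λ z → + n' ℤ.+ z) (ℤP.pos-* P t))) ⟩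
    ℤ.- + c ℤ.* (+ n' ℤ.+ + P ℤ.* + t)
      ≡⟨ solve 4 (λ c n' P t → :- c :* (n' :+ P :* t) := :- (c :* n') :- c :* (P :* t))
               refl (+ c) (+ n') (+ P) (+ t) ⟩
    ℤ.- (+ c ℤ.* + n') ℤ.- + c ℤ.* (+ P ℤ.* + t)
      ≡⟨ cong (λ z → ℤ.- z ℤ.- + c ℤ.* (+ P ℤ.* + t)) (RatioIn-ℤ p K c n n' t eq) ⟩
    ℤ.- (+ n ℤ.* (+ P ℤ.* + t)) ℤ.- + c ℤ.* (+ P ℤ.* + t)
      ≡⟨ solve 4 (λ n c P t → :- (n :* (P :* t)) :- c :* (P :* t) := (n :+ c) :* (P :* :- t))
               refl (+ n) (+ c) (+ P) (+ t) ⟩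
    (+ n ℤ.+ + c) ℤ.* (+ P ℤ.* ℤ.- + t)
      ≡⟨ cong (ℤ._* (+ P ℤ.* ℤ.- + t)) (sym (ℤP.pos-+ n c)) ⟩
    + (n + c) ℤ.* (+ P ℤ.* ℤ.- + t) ∎

split-below : ∀ p j n → ¬ (p ^ j ∣ n) →
              Σ ℕ λ ℓ → Σ ℕ λ n' → ℓ < j × n ≡ p ^ ℓ * n' × ¬ (p ∣ n')
split-below p zero    n pʲ∤n = ⊥-elim (pʲ∤n (ℕ∣.1∣ n))
split-below p (suc j) n pʲ∤n with p ℕ∣.∣? n
... | no p∤n = 0 , n , s≤s z≤n , sym (ℕP.+-identityʳ n) , p∤n
... | yes (divides q n≡q*p) with split-below p j q pʲ∤q
  where
  pʲ∤q : ¬ (p ^ j ∣ q)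
  pʲ∤q pʲ∣q = pʲ∤n (subst₂ _∣_ (ℕP.*-comm (p ^ j) p) (sym n≡q*p) (ℕ∣.*-monoˡ-∣ p pʲ∣q))
...   | ℓ , n' , ℓ<j , q≡pˡn' , p∤n' = suc ℓ , n' , s≤s ℓ<j , n≡ , p∤n'
  where
  open ℕSolver.+-*-Solver
  n≡ : n ≡ p * p ^ ℓ * n'
  n≡ = trans n≡q*p (trans (cong (_* p) q≡pˡn')
         (solve 3 (λ p pˡ n' → pˡ :* n' :* p := p :* pˡ :* n') refl p (p ^ ℓ) n'))

-- If p^j ∤ n and j + K ≤ s + 1, then (G · p^s)/n ∈ p^K ℤ_(p): writing
-- n = p^ℓ n' with ℓ < j, the quotient is G p^(s-ℓ)/n' and s - ℓ ≥ K.
power-ratio : ∀ p j K s G n → ¬ (p ^ j ∣ n) → j + K ≤ suc s → RatioIn p K (G * p ^ s) n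
power-ratio p j K s G n pʲ∤n j+K≤1+s with split-below p j n pʲ∤n
... | ℓ , n' , ℓ<j , n≡pˡn' , p∤n' = n' , G * p ^ r , p∤n' , eq
  where
  open ≡-Reasoning
  open ℕSolver.+-*-Solver
  ℓ+K≤s : ℓ + K ≤ s
  ℓ+K≤s = ℕP.≤-pred (ℕP.≤-trans (ℕP.+-monoˡ-≤ K ℓ<j) j+K≤1+s)
  r : ℕ
  r = s ∸ (ℓ + K)
  pˢ≡ : p ^ s ≡ p ^ ℓ * p ^ K * p ^ r
  pˢ≡ = trans (cong (p ^_) (sym (ℕP.m+[n∸m]≡n ℓ+K≤s)))
        (trans (ℕP.^-distribˡ-+-* p (ℓ + K) r) (cong (_* p ^ r) (ℕP.^-distribˡ-+-* p ℓ K)))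
  eq : G * p ^ s * n' ≡ n * (p ^ K * (G * p ^ r))
  eq = begin
    G * p ^ s * n'                         ≡⟨ cong (λ z → G * z * n') pˢ≡ ⟩
    G * (p ^ ℓ * p ^ K * p ^ r) * n'       ≡⟨ solve 5 (λ G pˡ pᴷ pʳ n' → G :* (pˡ :* pᴷ :* pʳ) :* n'
                                                        := pˡ :* n' :* (pᴷ :* (G :* pʳ)))
                                                refl G (p ^ ℓ) (p ^ K) (p ^ r) n' ⟩
    p ^ ℓ * n' * (p ^ K * (G * p ^ r))     ≡⟨ cong (_* (p ^ K * (G * p ^ r))) (sym n≡pˡn') ⟩
    n * (p ^ K * (G * p ^ r))              ∎

block-1+pᴷℤₚ : ∀ {p} → Prime p → ∀ j K s G a L → j + K ≤ suc s → 1 ≤ K →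
               (∀ k → k < L → ¬ (p ^ j ∣ suc (k + a))) →
               In1+pℤp p K (Πℚ L (factor (G * p ^ s) a)) ×
               In1+pℤp p K (Πℚ L (factorInv (G * p ^ s) a))
block-1+pᴷℤₚ {p} pp j K s G a L j+K≤1+s 1≤K no-multiple =
  Πℚ-1+pᴷℤₚ K pp L (factor c a) (λ k k<L → factor-1+pᴷℤₚ {p} {K} c a k (ratio k k<L)) ,
  Πℚ-1+pᴷℤₚ K pp L (factorInv c a) (λ k k<L → factorInv-1+pᴷℤₚ {p} {K} c a k 1≤K (ratio k k<L))
  where
  c : ℕ
  c = G * p ^ s
  ratio : ∀ k → k < L → RatioIn p K c (suc (k + a))
  ratio k k<L = power-ratio p j K s G (suc (k + a)) (no-multiple k k<L) j+K≤1+s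

Σℕ-cong : ∀ n {g h : Fin n → ℕ} → (∀ k → g k ≡ h k) → Σℕ n g ≡ Σℕ n h
Σℕ-cong zero    _   = refl
Σℕ-cong (suc n) g≗h = cong₂ _+_ (g≗h zero) (Σℕ-cong n (λ k → g≗h (suc k)))

Σℕ-+ : ∀ n (g h : Fin n → ℕ) → Σℕ n (λ k → g k + h k) ≡ Σℕ n g + Σℕ n h
Σℕ-+ zero    g h = refl
Σℕ-+ (suc n) g h = trans (cong (λ z → g zero + h zero + z) (Σℕ-+ n _ _))
  (solve 4 (λ a b c d → a :+ b :+ (c :+ d) := a :+ c :+ (b :+ d)) refl
     (g zero) (h zero) (Σℕ n (λ k → g (suc k))) (Σℕ n (λ k → h (suc k))))
  where open ℕSolver.+-*-Solver

Σℕ-* : ∀ n c (g : Fin n → ℕ) → Σℕ n (λ k → c * g k) ≡ c * Σℕ n g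
Σℕ-* zero    c g = sym (ℕP.*-zeroʳ c)
Σℕ-* (suc n) c g = trans (cong (λ z → c * g zero + z) (Σℕ-* n c _)) (sym (ℕP.*-distribˡ-+ c (g zero) _))

·ℕ-+* : ∀ {d} (g x y : Vecℕ d) c → Σℕ d (λ k → g k * (x k + c * y k)) ≡ g ·ℕ x + c * (g ·ℕ y)
·ℕ-+* {d} g x y c =
  trans (Σℕ-cong d (λ k → solve 4 (λ g x c y → g :* (x :+ c :* y) := g :* x :+ c :* (g :* y))
                                   refl (g k) (x k) c (y k)))
  (trans (Σℕ-+ d _ _) (cong (λ z → g ·ℕ x + z) (Σℕ-* d c _)))
  where open ℕSolver.+-*-Solver

shift-mod : ∀ v u p Q .{{_ : NonZero Q}} .{{_ : NonZero (p * Q)}} → v < p →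
            (v + u * p) ℕ.% (p * Q) ≡ v + p * (u ℕ.% Q)
shift-mod v u p Q v<p = begin
  (v + u * p) ℕ.% (p * Q)              ≡⟨ cong (ℕ._% (p * Q)) split ⟩
  (v + p * r + q * (p * Q)) ℕ.% (p * Q) ≡⟨ ℕD.[m+kn]%n≡m%n (v + p * r) q (p * Q) ⟩
  (v + p * r) ℕ.% (p * Q)              ≡⟨ ℕD.m<n⇒m%n≡m small ⟩
  v + p * r                            ∎
  where
  open ≡-Reasoning
  open ℕSolver.+-*-Solver
  r q : ℕ
  r = u ℕ.% Q
  q = u ℕ./ Q
  split : v + u * p ≡ v + p * r + q * (p * Q)
  split = trans (cong (λ z → v + z * p) (ℕD.m≡m%n+[m/n]*n u Q))
    (solve 5 (λ v r q p Q → v :+ (r :+ q :* Q) :* p := v :+ p :* r :+ q :* (p :* Q)) refl v r q p Q)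
  small : v + p * r < p * Q
  small = ℕP.<-≤-trans (ℕP.+-monoˡ-< (p * r) v<p)
          (ℕP.≤-trans (ℕP.≤-reflexive (sym (ℕP.*-suc p r))) (ℕP.*-monoʳ-≤ p (ℕD.m%n<n u Q)))

-- With R = Σ_k g_k (u_k mod Q) we have g·u ≡ R (mod Q),
-- and the hypothesis says g·v + p R < pQ, so R + ⌊g·v/p⌋ < Q.
no-multiple : ∀ {d} p Q .{{_ : NonZero p}} .{{_ : NonZero Q}} (g v u : Vecℕ d) →
              (∀ k → v k < p) →
              Σℕ d (λ k → g k * ((v k + u k * p) ℕ.% (p * Q)) {{ℕP.m*n≢0 p Q}}) < p * Q →
              ∀ k → k < (g ·ℕ v) ℕ./ p → ¬ (Q ∣ suc (k + g ·ℕ u))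
no-multiple {d} p Q g v u v<p weight<pQ k k<L Q∣n =
  ℕP.<-irrefl refl (ℕP.<-≤-trans 1+k+R<Q (ℕ∣.∣⇒≤ Q∣1+k+R))
  where
  instance
    pQ≢0 : NonZero (p * Q)
    pQ≢0 = ℕP.m*n≢0 p Q
  open ℕSolver.+-*-Solver
  V R A : ℕ
  V = g ·ℕ v
  R = Σℕ d (λ k → g k * (u k ℕ.% Q))
  A = Σℕ d (λ k → g k * (u k ℕ./ Q))
  V+pR<pQ : V + p * R < p * Q
  V+pR<pQ = subst (_< p * Q)
    (trans (Σℕ-cong d (λ k → cong (g k *_) (shift-mod (v k) (u k) p Q (v<p k))))
           (·ℕ-+* g v (λ k → u k ℕ.% Q) p))
    weight<pQ
  L+R<Q : V ℕ./ p + R < Q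
  L+R<Q = ℕP.*-cancelˡ-< p (V ℕ./ p + R) Q (ℕP.≤-<-trans pL+pR≤V+pR V+pR<pQ)
    where
    pL+pR≤V+pR : p * (V ℕ./ p + R) ≤ V + p * R
    pL+pR≤V+pR = ℕP.≤-trans
      (ℕP.≤-reflexive (trans (ℕP.*-distribˡ-+ p (V ℕ./ p) R) (cong (_+ p * R) (ℕP.*-comm p (V ℕ./ p)))))
      (ℕP.+-monoˡ-≤ (p * R) (ℕD.m/n*n≤m V p))
  1+k+R<Q : suc k + R < Q
  1+k+R<Q = ℕP.≤-<-trans (ℕP.+-monoˡ-≤ R k<L) L+R<Q
  g·u≡R+QA : g ·ℕ u ≡ R + Q * A
  g·u≡R+QA = trans (Σℕ-cong d (λ k → cong (g k *_) (trans (ℕD.m≡m%n+[m/n]*n (u k) Q)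
                                                         (cong (λ z → u k ℕ.% Q + z) (ℕP.*-comm (u k ℕ./ Q) Q)))))
                   (·ℕ-+* g (λ k → u k ℕ.% Q) (λ k → u k ℕ./ Q) Q)
  Q∣1+k+R : Q ∣ suc k + R
  Q∣1+k+R = ℕ∣.∣m+n∣m⇒∣n (subst (Q ∣_) n≡ Q∣n) (ℕ∣.m∣m*n A)
    where
    n≡ : suc (k + g ·ℕ u) ≡ Q * A + (suc k + R)
    n≡ = trans (cong (λ z → suc (k + z)) g·u≡R+QA)
      (solve 4 (λ k R Q A → con 1 :+ (k :+ (R :+ Q :* A)) := Q :* A :+ (con 1 :+ k :+ R)) refl k R Q A)

floor-mkℚ+ : ∀ a b .{{_ : NonZero b}} .(c : Coprime a b) → ℚ.floor (ℚ.mkℚ+ a b c) ≡ + (a ℕ./ b)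
floor-mkℚ+ a (suc b) c = ℤP.*-identityˡ _

-- ⌊N/D⌋ = N div D: dividing numerator and denominator by their gcd does not
-- change the quotient.
floor-/ : ∀ N D .{{_ : NonZero D}} → ℚ.floor ((+ N) / D) ≡ + (N ℕ./ D)
floor-/ N D {{D≢0}} = trans (floor-mkℚ+ (N ℕ./ g) (D ℕ./ g) (coprime-/gcd N D)) (cong +_ quotient)
  where
  g : ℕ
  g = gcd N D
  instance
    g≢0 : NonZero g
    g≢0 = ℕ.≢-nonZero (gcd[m,n]≢0 N D (inj₂ (ℕ.≢-nonZero⁻¹ D)))
    D/g≢0 : NonZero (D ℕ./ g)
    D/g≢0 = ℕ.≢-nonZero (n/gcd[m,n]≢0 N D {{D≢0}} {{g≢0}})
    g*D/g≢0 : NonZero (g * (D ℕ./ g))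
    g*D/g≢0 = ℕP.m*n≢0 g (D ℕ./ g)
  g*[m/g]≡m : ∀ {m} → g ∣ m → g * (m ℕ./ g) ≡ m
  g*[m/g]≡m g∣m = trans (ℕP.*-comm g _) (ℕD.m/n*n≡m g∣m)
  quotient : (N ℕ./ g) ℕ./ (D ℕ./ g) ≡ N ℕ./ D
  quotient = trans (sym (ℕD.m*n/m*o≡n/o g (N ℕ./ g) (D ℕ./ g)))
             (trans (ℕD./-congˡ {o = g * (D ℕ./ g)} (g*[m/g]≡m (gcd[m,n]∣m N D)))
                    (ℕD./-congʳ {m = N} (g*[m/g]≡m (gcd[m,n]∣n N D))))

frac-/ : ∀ N D .{{_ : NonZero D}} → frac ((+ N) / D) ≡ (+ (N ℕ.% D)) / D
frac-/ N D =
  trans (cong (λ z → ((+ N) / D) ℚ.- ℤtoℚ z) (floor-/ N D))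
  (trans (cong (((+ N) / D) ℚ.+_) (/-neg (+ q) 1))
  (trans (/-+ (+ N) D (ℤ.- (+ q)) 1)
         (/-cross (+ N ℤ.* + 1 ℤ.+ ℤ.- (+ q) ℤ.* + D) (D * 1) (+ r) D {{ℕP.m*n≢0 D 1}} cross)))
  where
  open ≡-Reasoning
  open ℤSolver.+-*-Solver
  q r : ℕ
  q = N ℕ./ D
  r = N ℕ.% D
  N≡r+qD : + N ≡ + r ℤ.+ + q ℤ.* + D
  N≡r+qD = trans (cong +_ (ℕD.m≡m%n+[m/n]*n N D))
           (trans (ℤP.pos-+ r (q * D)) (cong (λ z → + r ℤ.+ z) (ℤP.pos-* q D)))
  cross : (+ N ℤ.* + 1 ℤ.+ ℤ.- (+ q) ℤ.* + D) ℤ.* + D ≡ + r ℤ.* + (D * 1)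
  cross = begin
    (+ N ℤ.* + 1 ℤ.+ ℤ.- (+ q) ℤ.* + D) ℤ.* + D
      ≡⟨ cong (λ z → (z ℤ.* + 1 ℤ.+ ℤ.- (+ q) ℤ.* + D) ℤ.* + D) N≡r+qD ⟩
    ((+ r ℤ.+ + q ℤ.* + D) ℤ.* + 1 ℤ.+ ℤ.- (+ q) ℤ.* + D) ℤ.* + D
      ≡⟨ solve 3 (λ r q D → ((r :+ q :* D) :* con (+ 1) :+ :- q :* D) :* D := r :* (D :* con (+ 1)))
               refl (+ r) (+ q) (+ D) ⟩
    + r ℤ.* (+ D ℤ.* + 1)
      ≡⟨ cong (λ z → + r ℤ.* z) (sym (ℤP.pos-* D 1)) ⟩
    + r ℤ.* + (D * 1) ∎

scale-/ : ∀ a M D .{{_ : NonZero D}} → ℕtoℚ a ℚ.* ((+ M) / D) ≡ (+ (a * M)) / D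
scale-/ a M D = trans (/-* (+ a) 1 (+ M) D)
  (/-cross (+ a ℤ.* + M) (1 * D) (+ (a * M)) D {{ℕP.m*n≢0 1 D}}
     (cong₂ ℤ._*_ (sym (ℤP.pos-* a M)) (cong +_ (sym (ℕP.*-identityˡ D)))))

add-/ : ∀ X Y D .{{_ : NonZero D}} → ((+ X) / D) ℚ.+ ((+ Y) / D) ≡ (+ (X + Y)) / D
add-/ X Y D = trans (/-+ (+ X) D (+ Y) D)
  (/-cross (+ X ℤ.* + D ℤ.+ + Y ℤ.* + D) (D * D) (+ (X + Y)) D {{ℕP.m*n≢0 D D}}
     (trans (solve 3 (λ X Y D → (X :* D :+ Y :* D) :* D := (X :+ Y) :* (D :* D)) refl (+ X) (+ Y) (+ D))
            (sym (cong₂ ℤ._*_ (ℤP.pos-+ X Y) (ℤP.pos-* D D)))))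
  where open ℤSolver.+-*-Solver

·ℚ-frac : ∀ n (g N : Fin n → ℕ) D .{{_ : NonZero D}} →
          Σℚ n (λ k → ℕtoℚ (g k) ℚ.* frac ((+ N k) / D)) ≡ (+ Σℕ n (λ k → g k * (N k ℕ.% D))) / D
·ℚ-frac zero    g N D = /-cross (+ 0) 1 (+ 0) D refl
·ℚ-frac (suc n) g N D =
  trans (cong₂ ℚ._+_ (trans (cong (ℕtoℚ (g zero) ℚ.*_) (frac-/ (N zero) D)) (scale-/ (g zero) (N zero ℕ.% D) D))
                     (·ℚ-frac n (λ k → g (suc k)) (λ k → N (suc k)) D))
        (add-/ (g zero * (N zero ℕ.% D)) (Σℕ n (λ k → g (suc k) * (N (suc k) ℕ.% D))) D)

proper-fraction : ∀ M D .{{_ : NonZero D}} → M < D → ℚ.0ℚ ℚ.≤ (+ M) / D × (+ M) / D ℚ.< ℚ.1ℚ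
proper-fraction M D M<D =
  /-≤ (+ 0) 1 (+ M) D (subst (ℤ.0ℤ ℤ.≤_) (sym (ℤP.*-identityʳ (+ M))) (ℤ.+≤+ z≤n)) ,
  /-< (+ M) D (+ 1) 1 (subst₂ ℤ._<_ (sym (ℤP.*-identityʳ (+ M))) (sym (ℤP.*-identityˡ (+ D))) (ℤ.+<+ M<D))

1≤/ : ∀ S D .{{_ : NonZero D}} → D ≤ S → ℚ.1ℚ ℚ.≤ (+ S) / D
1≤/ S D D≤S = /-≤ (+ 1) 1 (+ S) D
  (subst₂ ℤ._≤_ (sym (ℤP.*-identityˡ (+ D))) (sym (ℤP.*-identityʳ (+ S))) (ℤ.+≤+ D≤S))

-- If {N/D} ∉ 𝒟, every e_i and f_i has weight Σ_k g_k (N_k mod D) < D: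
-- the point lies in [0,1)^d, so a weight ≥ D would put it in 𝒟.
short-weights : ∀ {d q₁ q₂} (e : Fin q₁ → Vecℕ d) (f : Fin q₂ → Vecℕ d) (N : Vecℕ d) D .{{_ : NonZero D}} →
                ¬ In𝒟 e f (λ k → frac ((+ N k) / D)) →
                (∀ i → Σℕ d (λ k → e i k * (N k ℕ.% D)) < D) ×
                (∀ i → Σℕ d (λ k → f i k * (N k ℕ.% D)) < D)
short-weights {d} e f N D x∉𝒟 =
  (λ i → short (e i) (λ 1≤e·x → x∉𝒟 (in-cube , inj₁ (i , 1≤e·x)))) ,
  (λ i → short (f i) (λ 1≤f·x → x∉𝒟 (in-cube , inj₂ (i , 1≤f·x))))
  where
  x : Vecℚ d
  x k = frac ((+ N k) / D)
  in-cube : ∀ k → ℚ.0ℚ ℚ.≤ x k × x k ℚ.< ℚ.1ℚ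
  in-cube k = subst (λ z → ℚ.0ℚ ℚ.≤ z × z ℚ.< ℚ.1ℚ) (sym (frac-/ (N k) D))
                    (proper-fraction (N k ℕ.% D) D (ℕD.m%n<n (N k) D))
  short : ∀ g → ¬ (ℚ.1ℚ ℚ.≤ g ·ℚ x) → Σℕ d (λ k → g k * (N k ℕ.% D)) < D
  short g g·x<1 with Σℕ d (λ k → g k * (N k ℕ.% D)) ℕ.<? D
  ... | yes weight<D = weight<D
  ... | no  weight≮D = ⊥-elim (g·x<1 (subst (ℚ.1ℚ ℚ.≤_) (sym (·ℚ-frac d g N D))
                                             (1≤/ _ D (ℕP.≮⇒≥ weight≮D))))

exponent-bounds : ∀ s j → j ≤ s → j + (s + 2 ∸ suc j) ≤ suc s × 1 ≤ s + 2 ∸ suc j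
exponent-bounds s j j≤s = subst (λ K → j + K ≤ suc s × 1 ≤ K) (sym K≡) bounds
  where
  K≡ : s + 2 ∸ suc j ≡ suc s ∸ j
  K≡ = cong (_∸ suc j) (ℕP.+-comm s 2)
  bounds : j + (suc s ∸ j) ≤ suc s × 1 ≤ suc s ∸ j
  bounds = ℕP.≤-reflexive (ℕP.m+[n∸m]≡n (ℕP.m≤n⇒m≤1+n j≤s)) , ℕP.m<n⇒0<n∸m (s≤s j≤s)

-- The theorem.  Only the position of the point {(v + u p)/p^j} relative to 𝒟
-- is used.
lemma13 : ∀ {d q₁ q₂ : ℕ} (e : Fin q₁ → Vecℕ d) (f : Fin q₂ → Vecℕ d) →
    (∀ i → ¬ (∀ k → e i k ≡ 0)) →
    (∀ i → ¬ (∀ k → f i k ≡ 0)) →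
    (∀ i j → ¬ (∀ k → e i k ≡ f j k)) →
    (∀ k → Σℕ q₁ (λ i → e i k) ≡ Σℕ q₂ (λ j → f j k)) →
    (∀ (x : Vecℚ d) → (∀ k → ℚ.0ℚ ℚ.≤ x k × x k ℚ.≤ ℚ.1ℚ) → ℤ.0ℤ ℤ.≤ Δ e f x) →
    (∀ (x : Vecℚ d) → In𝒟 e f x → ℤ.1ℤ ℤ.≤ Δ e f x) →
    (p : ℕ) (pp : Prime p) (s : ℕ) (v u : Vecℕ d) →
    (∀ k → v k < p) →
    (∀ k → u k < p ^ s) →
    (j : ℕ) → 1 ≤ j → j ≤ s + 1 → ¬ In𝒟 e f (fracPt p pp v u j) →
    ∀ (m : Vecℕ d) → In1+pℤp p (s + 2 ∸ j) (Y e f p pp s v u m)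
lemma13 e f _ _ _ _ _ _ p pp s v u _ _ zero () _ _ _
lemma13 {d} {q₁} {q₂} e f _ _ _ _ _ _ p pp s v u v<p _ (suc j') _ j'+1≤s+1 x∉𝒟 m =
  *-1+pᴷℤₚ K pp {ΠFinℚ q₂ (numerator-block ∘ f)} {ΠFinℚ q₁ (denominator-block ∘ e)}
    (ΠFinℚ-1+pᴷℤₚ K pp q₂ (numerator-block ∘ f) (λ i → proj₁ (blocks (f i) (proj₂ weights i))))
    (ΠFinℚ-1+pᴷℤₚ K pp q₁ (denominator-block ∘ e) (λ i → proj₂ (blocks (e i) (proj₁ weights i))))
  where
  instance
    p≢0 : NonZero p
    p≢0 = prime⇒nonZero pp
    Q≢0 : NonZero (p ^ j')
    Q≢0 = ℕP.m^n≢0 p j'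
    D≢0 : NonZero (p * p ^ j')
    D≢0 = ℕP.m^n≢0 p (suc j')
  K : ℕ
  K = s + 2 ∸ suc j'
  numerator-block denominator-block : Vecℕ d → ℚ
  numerator-block   g = Πℚ ((g ·ℕ v) ℕ./ p) (factor    ((g ·ℕ m) * p ^ s) (g ·ℕ u))
  denominator-block g = Πℚ ((g ·ℕ v) ℕ./ p) (factorInv ((g ·ℕ m) * p ^ s) (g ·ℕ u))
  weights : (∀ i → Σℕ d (λ k → e i k * ((v k + u k * p) ℕ.% (p * p ^ j'))) < p * p ^ j') ×
            (∀ i → Σℕ d (λ k → f i k * ((v k + u k * p) ℕ.% (p * p ^ j'))) < p * p ^ j')
  weights = short-weights e f (λ k → v k + u k * p) (p * p ^ j') x∉𝒟
  K-bounds : j' + K ≤ suc s × 1 ≤ K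
  K-bounds = exponent-bounds s j' (ℕP.≤-pred (subst (suc j' ≤_) (ℕP.+-comm s 1) j'+1≤s+1))
  blocks : ∀ g → Σℕ d (λ k → g k * ((v k + u k * p) ℕ.% (p * p ^ j'))) < p * p ^ j' →
           In1+pℤp p K (numerator-block g) × In1+pℤp p K (denominator-block g)
  blocks g weight<D = block-1+pᴷℤₚ pp j' K s (g ·ℕ m) (g ·ℕ u) ((g ·ℕ v) ℕ./ p)
    (proj₁ K-bounds) (proj₂ K-bounds) (no-multiple p (p ^ j') g v u v<p weight<D)
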